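{- Let $\mathcal{X}=(U,\mathbf{X})$ and $\mathcal{Y}=(U,\mathbf{Y})$ be hypergraphs on the same finite vertex set $U$, and let $\sigma=\sigma_{\mathcal{X},\mathcal{Y}}$. Suppose $T\subseteq U$ is $\sigma$-maximal. Then: (1) $Y\subseteq T$ for every $Y\in\mathbf{Y}$; (2) for every $X\in\mathbf{X}$, either $X\subseteq T$ or $|T\cap X|$ is even; (3) $\mathcal{X}[U\setminus T]$ is a hyperforest.
   Context: For hypergraphs $\mathcal{X}=(U,\mathbf{X})$, $\mathcal{Y}=(U,\mathbf{Y})$ define $\sigma_{\mathcal{X},\mathcal{Y}}:2^U\to\mathbb{Z}$ by $\sigma(T)=r(T)-|T|$ where $r(T)=\sum_{X\in\mathbf{X}}\lfloor |T\cap X|/2\rfloor+\sum_{Y\in\mathbf{Y}}|T\cap Y|$. A set $T\subseteq U$ is $\sigma$-maximal if $\sigma(S)\le\sigma(T)$ for every $S\subseteq U$ and $\sigma(T')<\sigma(T)$ for every $T'\supsetneq T$. For $W\subseteq U$, $\mathcal{X}[W]$ denotes the hypergraph with vertex set $W$ and edges the nonempty sets $X\cap W$, $X\in\mathbf{X}$. The incidence graph of a hypergraph $\mathcal{H}=(U,\mathbf{H})$ is the bipartite graph with parts $U$ and $\mathbf{H}$ in which $u\in U$ is adjacent to $S\in\mathbf{H}$ iff $u\in S$; $\mathcal{H}$ is a hyperforest if its incidence graph has no cycles. -}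

module Defs where

open import Data.Nat as ℕ using (ℕ; _/_)
open import Data.Integer as ℤ using (ℤ; +_; _-_)
open import Data.Fin using (Fin; zero; suc; toℕ; fromℕ<)
open import Data.Fin.Subset using (Subset; _∩_; _∈_; _⊆_; _⊂_; ∣_∣; Nonempty)
open import Data.Fin.Subset.Properties using (nonempty?)
open import Data.List using (List; map; filter; length; lookup)
open import Data.Nat.ListAction using (sum)
open import Data.Product using (Σ; _×_)
open import Function.Definitions using (Injective)
open import Relation.Binary.PropositionalEquality using (_≡_)
open import Relation.Nullary using (¬_; yes; no)

-- A hypergraph on the finite vertex set U = Fin n is given by its family
-- (list, multiplicities allowed) of edges, each a subset of U.
-- r(T) = Σ_{X ∈ Xs} ⌊|T ∩ X|/2⌋ + Σ_{Y ∈ Ys} |T ∩ Y|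
r : {n : ℕ} → List (Subset n) → List (Subset n) → Subset n → ℕ
r Xs Ys T = sum (map (λ X → ∣ T ∩ X ∣ / 2) Xs) ℕ.+ sum (map (λ Y → ∣ T ∩ Y ∣) Ys)

σ : {n : ℕ} → List (Subset n) → List (Subset n) → Subset n → ℤ
σ Xs Ys T = + r Xs Ys T - + ∣ T ∣

σ-maximal : {n : ℕ} → List (Subset n) → List (Subset n) → Subset n → Set
σ-maximal {n} Xs Ys T =
  ((S : Subset n) → σ Xs Ys S ℤ.≤ σ Xs Ys T) ×
  ((T' : Subset n) → T ⊂ T' → σ Xs Ys T' ℤ.< σ Xs Ys T)

record Hypergraph (n : ℕ) : Set where
  constructor hypergraph
  field
    vertices : Subset n
    edges    : List (Subset n)
open Hypergraph public

induced : {n : ℕ} → List (Subset n) → Subset n → Hypergraph n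
induced Xs W = hypergraph W (filter nonempty? (map (_∩ W) Xs))

next : {k : ℕ} → Fin k → Fin k
next {ℕ.suc k} i with toℕ i ℕ.<? k
... | yes p = suc (fromℕ< p)
... | no _ = zero

-- A cycle in the incidence graph (bipartite: vertices of V vs. edges of Es).
-- Every cycle of a bipartite graph alternates, so it has the form
--   u₀ E₀ u₁ E₁ … u_{k-1} E_{k-1} u₀   with k ≥ 2,
-- the u_i pairwise distinct vertices in V, the E_i pairwise distinct edges
-- (as members of the edge family), and u_i ∈ E_i, u_{i+1 mod k} ∈ E_i.
IncidenceCycle : {n : ℕ} → Hypergraph n → Set
IncidenceCycle {n} H =
  Σ ℕ λ k → (2 ℕ.≤ k) ×
  (Σ (Fin k → Fin n) λ u → Σ (Fin k → Fin (length (edges H))) λ e →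
     Injective _≡_ _≡_ u × Injective _≡_ _≡_ e ×
     ((i : Fin k) → u i ∈ vertices H) ×
     ((i : Fin k) → (u i ∈ lookup (edges H) (e i)) × (u (next i) ∈ lookup (edges H) (e i))))

IsHyperforest : {n : ℕ} → Hypergraph n → Set
IsHyperforest H = ¬ IncidenceCycle H

-- Each claim is proved by exhibiting a strict superset T ∪ C of T with
-- r(T ∪ C) ≥ r(T) + |C|, hence σ(T ∪ C) ≥ σ(T), contradicting maximality.
-- (1) A vertex of some Y outside T raises the Y-term by one.  (2) A vertex of X
-- outside T raises ⌊|T ∩ X|/2⌋ by one when |T ∩ X| is odd.  (3) The k vertices
-- of a cycle of 𝒳[U ∖ T] lie outside T, and each of the k distinct edges of the
-- cycle contains two of them, so r grows by at least k ≥ |C|.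
module Submission where

open import Defs
open import Data.Nat using (ℕ)
open import Data.Nat.Divisibility using (_∣_)
open import Data.Fin.Subset using (Subset; _∩_; _⊆_; ∣_∣; ∁)
open import Data.List using (List)
open import Data.List.Membership.Propositional using () renaming (_∈_ to _∈ₗ_)
open import Data.Product using (_×_)
open import Data.Sum using (_⊎_)

open import Data.Nat using (zero; suc; _+_; _≤_; _<_; z≤n; s≤s; s≤s⁻¹; z<s; _/_; _<?_)
open import Data.Nat.Properties
open import Algebra.Properties.CommutativeSemigroup +-commutativeSemigroup
  using (interchange; xy∙z≈xz∙y; x∙yz≈xz∙y)
open import Data.Nat.DivMod using (/-monoˡ-≤; m/n≡1+[m∸n]/n; m≥n⇒m/n>0)
open import Data.Nat.Divisibility using (_∣?_; ∣-refl; ∣m∣n⇒∣m+n; _∣0)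
open import Data.Bool using (true; false)
open import Data.Nat.ListAction using (sum)
open import Data.Integer as ℤ using ()
import Data.Integer.Properties as ℤ
open import Data.Integer.Tactic.RingSolver using (solve-∀)
open import Data.Fin using (Fin; zero; suc; toℕ; punchIn; punchOut)
open import Data.Fin.Properties
  using (any?; injective⇒≤; punchIn-injective; punchIn-punchOut; punchOut-injective;
         punchInᵢ≢i; toℕ-fromℕ<)
  renaming (_≟_ to _≟ᶠ_)
open import Data.Fin.Subset using (_∈_; _∉_; _∪_; ⁅_⁆; ⊥; inside; outside)
open import Data.Fin.Subset.Properties
  using (_∈?_; nonempty?; p⊆p∪q; q⊆p∪q; x∈p∩q⁺; x∈∁p⇒x∉p; x∉p⇒x∈∁p; x∈⁅x⁆; ∣⁅x⁆∣≡1;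
         ∣⊥∣≡0; ∣p∣≤∣x∷p∣; x∈p⇒∣p-x∣<∣p∣; x∈p∧x≢y⇒x∈p-y)
open import Data.List using ([]; _∷_; map; filter; length; lookup)
open import Data.List.Properties using (map-∘)
open import Data.Vec using ([]; _∷_)
open import Data.List.Relation.Unary.Any using (here; there)
open import Data.Product using (_,_; proj₁; proj₂)
open import Data.Sum using (inj₁; inj₂)
open import Function using (_∘_)
open import Function.Definitions using (Injective)
open import Relation.Binary.PropositionalEquality
open import Relation.Nullary using (¬_; yes; no; does; contradiction)
open import Relation.Nullary.Decidable using (decidable-stable)
open import Relation.Unary using (Decidable)

private
  variable
    n : ℕ
    p : Subset n
    x y : Fin n

∣p∪q∣≤∣p∣+∣q∣ : ∀ (p q : Subset n) → ∣ p ∪ q ∣ ≤ ∣ p ∣ + ∣ q ∣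
∣p∪q∣≤∣p∣+∣q∣ []            []            = z≤n
∣p∪q∣≤∣p∣+∣q∣ (inside  ∷ p) (s       ∷ q) =
  s≤s (≤-trans (∣p∪q∣≤∣p∣+∣q∣ p q) (+-monoʳ-≤ ∣ p ∣ (∣p∣≤∣x∷p∣ s q)))
∣p∪q∣≤∣p∣+∣q∣ (outside ∷ p) (inside  ∷ q) =
  ≤-trans (s≤s (∣p∪q∣≤∣p∣+∣q∣ p q)) (≤-reflexive (sym (+-suc ∣ p ∣ ∣ q ∣)))
∣p∪q∣≤∣p∣+∣q∣ (outside ∷ p) (outside ∷ q) = ∣p∪q∣≤∣p∣+∣q∣ p q

∣p∩r∣+∣q∩r∩∁p∣≤∣[p∪q]∩r∣ : ∀ (p q r : Subset n) → ∣ p ∩ r ∣ + ∣ q ∩ (r ∩ ∁ p) ∣ ≤ ∣ (p ∪ q) ∩ r ∣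
∣p∩r∣+∣q∩r∩∁p∣≤∣[p∪q]∩r∣ [] [] [] = z≤n
∣p∩r∣+∣q∩r∩∁p∣≤∣[p∪q]∩r∣ (inside  ∷ p) (inside  ∷ q) (inside  ∷ r) =
  s≤s (∣p∩r∣+∣q∩r∩∁p∣≤∣[p∪q]∩r∣ p q r)
∣p∩r∣+∣q∩r∩∁p∣≤∣[p∪q]∩r∣ (inside  ∷ p) (outside ∷ q) (inside  ∷ r) =
  s≤s (∣p∩r∣+∣q∩r∩∁p∣≤∣[p∪q]∩r∣ p q r)
∣p∩r∣+∣q∩r∩∁p∣≤∣[p∪q]∩r∣ (outside ∷ p) (inside  ∷ q) (inside  ∷ r) =
  ≤-trans (≤-reflexive (+-suc ∣ p ∩ r ∣ _)) (s≤s (∣p∩r∣+∣q∩r∩∁p∣≤∣[p∪q]∩r∣ p q r))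
∣p∩r∣+∣q∩r∩∁p∣≤∣[p∪q]∩r∣ (outside ∷ p) (outside ∷ q) (inside  ∷ r) = ∣p∩r∣+∣q∩r∩∁p∣≤∣[p∪q]∩r∣ p q r
∣p∩r∣+∣q∩r∩∁p∣≤∣[p∪q]∩r∣ (inside  ∷ p) (inside  ∷ q) (outside ∷ r) = ∣p∩r∣+∣q∩r∩∁p∣≤∣[p∪q]∩r∣ p q r
∣p∩r∣+∣q∩r∩∁p∣≤∣[p∪q]∩r∣ (inside  ∷ p) (outside ∷ q) (outside ∷ r) = ∣p∩r∣+∣q∩r∩∁p∣≤∣[p∪q]∩r∣ p q r
∣p∩r∣+∣q∩r∩∁p∣≤∣[p∪q]∩r∣ (outside ∷ p) (inside  ∷ q) (outside ∷ r) = ∣p∩r∣+∣q∩r∩∁p∣≤∣[p∪q]∩r∣ p q r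
∣p∩r∣+∣q∩r∩∁p∣≤∣[p∪q]∩r∣ (outside ∷ p) (outside ∷ q) (outside ∷ r) = ∣p∩r∣+∣q∩r∩∁p∣≤∣[p∪q]∩r∣ p q r

∣p∩r∣≤∣[p∪q]∩r∣ : ∀ (p q r : Subset n) → ∣ p ∩ r ∣ ≤ ∣ (p ∪ q) ∩ r ∣
∣p∩r∣≤∣[p∪q]∩r∣ p q r = ≤-trans (m≤m+n _ _) (∣p∩r∣+∣q∩r∩∁p∣≤∣[p∪q]∩r∣ p q r)

x∈p⇒0<∣p∣ : x ∈ p → 0 < ∣ p ∣
x∈p⇒0<∣p∣ x∈p = <-≤-trans z<s (x∈p⇒∣p-x∣<∣p∣ x∈p)

x∈p∧y∈p∧x≢y⇒1<∣p∣ : x ∈ p → y ∈ p → x ≢ y → 1 < ∣ p ∣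
x∈p∧y∈p∧x≢y⇒1<∣p∣ x∈p y∈p x≢y =
  ≤-trans (s≤s (x∈p⇒0<∣p∣ (x∈p∧x≢y⇒x∈p-y y∈p (x≢y ∘ sym)))) (x∈p⇒∣p-x∣<∣p∣ x∈p)

x∈r∧x∉p⇒∣p∩r∣<∣[p∪⁅x⁆]∩r∣ : ∀ (p r : Subset n) → x ∈ r → x ∉ p → ∣ p ∩ r ∣ < ∣ (p ∪ ⁅ x ⁆) ∩ r ∣
x∈r∧x∉p⇒∣p∩r∣<∣[p∪⁅x⁆]∩r∣ {x = x} p r x∈r x∉p =
  <-≤-trans (m<m+n _ (x∈p⇒0<∣p∣ (x∈p∩q⁺ (x∈⁅x⁆ x , x∈p∩q⁺ (x∈r , x∉p⇒x∈∁p x∉p)))))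
            (∣p∩r∣+∣q∩r∩∁p∣≤∣[p∪q]∩r∣ p ⁅ x ⁆ r)

[2+m]/2≡1+m/2 : ∀ m → (2 + m) / 2 ≡ 1 + m / 2
[2+m]/2≡1+m/2 m = m/n≡1+[m∸n]/n {2 + m} {2} (s≤s (s≤s z≤n))

m/2+n/2≤[m+n]/2 : ∀ m n → m / 2 + n / 2 ≤ (m + n) / 2
m/2+n/2≤[m+n]/2 zero          n = ≤-refl
m/2+n/2≤[m+n]/2 (suc zero)    n = /-monoˡ-≤ 2 (n≤1+n n)
m/2+n/2≤[m+n]/2 (suc (suc m)) n rewrite [2+m]/2≡1+m/2 m | [2+m]/2≡1+m/2 (m + n) =
  s≤s (m/2+n/2≤[m+n]/2 m n)

2∤m⇒[1+m]/2≡1+m/2 : ∀ m → ¬ 2 ∣ m → (1 + m) / 2 ≡ 1 + m / 2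
2∤m⇒[1+m]/2≡1+m/2 zero          2∤m = contradiction (2 ∣0) 2∤m
2∤m⇒[1+m]/2≡1+m/2 (suc zero)    2∤m = refl
2∤m⇒[1+m]/2≡1+m/2 (suc (suc m)) 2∤m rewrite [2+m]/2≡1+m/2 m | [2+m]/2≡1+m/2 (suc m) =
  cong suc (2∤m⇒[1+m]/2≡1+m/2 m (2∤m ∘ ∣m∣n⇒∣m+n ∣-refl))

module _ {A : Set} where

  sum-map-mono : ∀ {f g : A → ℕ} → (∀ a → f a ≤ g a) → ∀ xs → sum (map f xs) ≤ sum (map g xs)
  sum-map-mono f≤g []       = z≤n
  sum-map-mono f≤g (a ∷ xs) = +-mono-≤ (f≤g a) (sum-map-mono f≤g xs)

  sum-map-mono-< : ∀ {f g : A → ℕ} → (∀ a → f a ≤ g a) → ∀ {a xs} → a ∈ₗ xs → f a < g a →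
                   sum (map f xs) < sum (map g xs)
  sum-map-mono-< f≤g {xs = _ ∷ xs} (here refl) fa<ga = +-mono-<-≤ fa<ga (sum-map-mono f≤g xs)
  sum-map-mono-< f≤g {xs = b ∷ _}  (there a∈xs) fa<ga = +-mono-≤-< (f≤g b) (sum-map-mono-< f≤g a∈xs fa<ga)

  sum-map-+ : ∀ (f g : A → ℕ) xs → sum (map (λ a → f a + g a) xs) ≡ sum (map f xs) + sum (map g xs)
  sum-map-+ f g []       = refl
  sum-map-+ f g (a ∷ xs) =
    trans (cong ((f a + g a) +_) (sum-map-+ f g xs)) (interchange (f a) (g a) _ _)

  sum-map-filter≤sum-map : ∀ {ℓ} {P : A → Set ℓ} (P? : Decidable P) (f : A → ℕ) xs →
                           sum (map f (filter P? xs)) ≤ sum (map f xs)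
  sum-map-filter≤sum-map P? f []       = z≤n
  sum-map-filter≤sum-map P? f (a ∷ xs) with does (P? a)
  ... | true  = +-monoʳ-≤ (f a) (sum-map-filter≤sum-map P? f xs)
  ... | false = ≤-trans (sum-map-filter≤sum-map P? f xs) (m≤n+m _ (f a))

  injective-into-support⇒≤sum-map : ∀ (h : A → ℕ) xs {k} (e : Fin k → Fin (length xs)) →
    Injective _≡_ _≡_ e → (∀ i → 0 < h (lookup xs (e i))) → k ≤ sum (map h xs)

  private
    avoiding-head⇒≤sum-map-tail :
      ∀ (h : A → ℕ) a xs {k} (e : Fin k → Fin (length (a ∷ xs))) → Injective _≡_ _≡_ e →
      (∀ i → zero ≢ e i) → (∀ i → 0 < h (lookup (a ∷ xs) (e i))) → k ≤ sum (map h xs)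
    avoiding-head⇒≤sum-map-tail h a xs e e-inj zero∉e pos =
      injective-into-support⇒≤sum-map h xs (λ i → punchOut (zero∉e i))
        (λ eq → e-inj (punchOut-injective (zero∉e _) (zero∉e _) eq))
        (λ i → subst (λ j → 0 < h (lookup (a ∷ xs) j)) (sym (punchIn-punchOut (zero∉e i))) (pos i))

  injective-into-support⇒≤sum-map h []       e e-inj _ = injective⇒≤ e-inj
  injective-into-support⇒≤sum-map h (a ∷ xs) e e-inj pos with any? (λ i → zero ≟ᶠ e i)
  ... | no zero∉e =
    ≤-trans (avoiding-head⇒≤sum-map-tail h a xs e e-inj (λ i eq → zero∉e (i , eq)) pos) (m≤n+m _ (h a))
  injective-into-support⇒≤sum-map h (a ∷ xs) {suc k} e e-inj pos | yes (i₀ , zero≡eᵢ₀) =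
    +-mono-≤ (subst (λ j → 0 < h (lookup (a ∷ xs) j)) (sym zero≡eᵢ₀) (pos i₀))
             (avoiding-head⇒≤sum-map-tail h a xs (e ∘ punchIn i₀)
               (punchIn-injective i₀ _ _ ∘ e-inj)
               (λ j zero≡e[j↑] → punchInᵢ≢i i₀ j (e-inj (trans (sym zero≡e[j↑]) zero≡eᵢ₀)))
               (pos ∘ punchIn i₀))

next-≢ : ∀ {k} → 2 ≤ k → (i : Fin k) → next i ≢ i
next-≢ {suc k} 2≤k i with toℕ i <? k
... | yes i<k = λ eq → 1+n≢n (trans (cong suc (sym (toℕ-fromℕ< i<k))) (cong toℕ eq))
... | no  i≮k = λ eq → i≮k (subst (λ j → toℕ j < k) eq (s≤s⁻¹ 2≤k))

image : ∀ {k} → (Fin k → Fin n) → Subset n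
image {k = zero}  u = ⊥
image {k = suc k} u = ⁅ u zero ⁆ ∪ image (u ∘ suc)

∣image∣≤k : ∀ {k} (u : Fin k → Fin n) → ∣ image u ∣ ≤ k
∣image∣≤k {n} {zero}  u = ≤-reflexive (∣⊥∣≡0 n)
∣image∣≤k {k = suc k} u = begin
  ∣ ⁅ u zero ⁆ ∪ image (u ∘ suc) ∣     ≤⟨ ∣p∪q∣≤∣p∣+∣q∣ ⁅ u zero ⁆ _ ⟩
  ∣ ⁅ u zero ⁆ ∣ + ∣ image (u ∘ suc) ∣ ≡⟨ cong (_+ ∣ image (u ∘ suc) ∣) (∣⁅x⁆∣≡1 (u zero)) ⟩
  suc ∣ image (u ∘ suc) ∣              ≤⟨ s≤s (∣image∣≤k (u ∘ suc)) ⟩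
  suc k                                ∎
  where open ≤-Reasoning

∈-image : ∀ {k} (u : Fin k → Fin n) i → u i ∈ image u
∈-image u zero    = p⊆p∪q _ (x∈⁅x⁆ (u zero))
∈-image u (suc i) = q⊆p∪q ⁅ u zero ⁆ _ (∈-image (u ∘ suc) i)

cycle-length≤∑⌊∣C∩E∣/2⌋ : ∀ (H : Hypergraph n) {k} → 2 ≤ k →
  (u : Fin k → Fin n) (e : Fin k → Fin (length (edges H))) →
  Injective _≡_ _≡_ u → Injective _≡_ _≡_ e →
  (∀ i → u i ∈ lookup (edges H) (e i) × u (next i) ∈ lookup (edges H) (e i)) →
  k ≤ sum (map (λ E → ∣ image u ∩ E ∣ / 2) (edges H))
cycle-length≤∑⌊∣C∩E∣/2⌋ H 2≤k u e u-inj e-inj u∈e =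
  injective-into-support⇒≤sum-map _ (edges H) e e-inj two-cycle-vertices-in
  where
  two-cycle-vertices-in : ∀ i → 0 < ∣ image u ∩ lookup (edges H) (e i) ∣ / 2
  two-cycle-vertices-in i = m≥n⇒m/n>0 (x∈p∧y∈p∧x≢y⇒1<∣p∣
    (x∈p∩q⁺ (∈-image u i , proj₁ (u∈e i)))
    (x∈p∩q⁺ (∈-image u (next i) , proj₂ (u∈e i)))
    (next-≢ 2≤k i ∘ sym ∘ u-inj))

sum-map-edges-induced≤ : ∀ (f : Subset n → ℕ) Xs W →
  sum (map f (edges (induced Xs W))) ≤ sum (map (λ X → f (X ∩ W)) Xs)
sum-map-edges-induced≤ f Xs W = begin
  sum (map f (filter nonempty? (map (_∩ W) Xs)))
    ≤⟨ sum-map-filter≤sum-map nonempty? f (map (_∩ W) Xs) ⟩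
  sum (map f (map (_∩ W) Xs))
    ≡⟨ cong sum (map-∘ Xs) ⟨
  sum (map (λ X → f (X ∩ W)) Xs)
    ∎
  where open ≤-Reasoning

+m-+n<+o-+p⇒m+p<o+n : ∀ m n o p → ℤ.+ m ℤ.- ℤ.+ n ℤ.< ℤ.+ o ℤ.- ℤ.+ p → m + p < o + n
+m-+n<+o-+p⇒m+p<o+n m n o p lt =
  ℤ.drop‿+<+ (subst₂ ℤ._<_ (cancel (ℤ.+ m) (ℤ.+ n) (ℤ.+ p)) (cancel′ (ℤ.+ o) (ℤ.+ p) (ℤ.+ n))
                           (ℤ.+-monoˡ-< (ℤ.+ n ℤ.+ ℤ.+ p) lt))
  where
  cancel : ∀ a b c → (a ℤ.- b) ℤ.+ (b ℤ.+ c) ≡ a ℤ.+ c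
  cancel = solve-∀
  cancel′ : ∀ a b c → (a ℤ.- b) ℤ.+ (c ℤ.+ b) ≡ a ℤ.+ c
  cancel′ = solve-∀

module _ (Xs Ys : List (Subset n)) (T : Subset n) where

  private
    rˣ rʸ : Subset n → ℕ
    rˣ S = sum (map (λ X → ∣ S ∩ X ∣ / 2) Xs)
    rʸ S = sum (map (λ Y → ∣ S ∩ Y ∣) Ys)

    rˣ-mono : ∀ C → rˣ T ≤ rˣ (T ∪ C)
    rˣ-mono C = sum-map-mono (λ X → /-monoˡ-≤ 2 (∣p∩r∣≤∣[p∪q]∩r∣ T C X)) Xs

    rʸ-mono : ∀ C → rʸ T ≤ rʸ (T ∪ C)
    rʸ-mono C = sum-map-mono (∣p∩r∣≤∣[p∪q]∩r∣ T C) Ys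

  r[T]+∑⌊∣C∩X∩∁T∣/2⌋≤r[T∪C] : ∀ C →
    r Xs Ys T + sum (map (λ X → ∣ C ∩ (X ∩ ∁ T) ∣ / 2) Xs) ≤ r Xs Ys (T ∪ C)
  r[T]+∑⌊∣C∩X∩∁T∣/2⌋≤r[T∪C] C = begin
    rˣ T + rʸ T + gain      ≡⟨ xy∙z≈xz∙y (rˣ T) (rʸ T) gain ⟩
    rˣ T + gain + rʸ T      ≤⟨ +-mono-≤ rˣ-gain (rʸ-mono C) ⟩
    rˣ (T ∪ C) + rʸ (T ∪ C) ∎
    where
    open ≤-Reasoning
    gain = sum (map (λ X → ∣ C ∩ (X ∩ ∁ T) ∣ / 2) Xs)
    rˣ-gain : rˣ T + gain ≤ rˣ (T ∪ C)
    rˣ-gain = begin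
      rˣ T + gain                                                ≡⟨ sum-map-+ _ _ Xs ⟨
      sum (map (λ X → ∣ T ∩ X ∣ / 2 + ∣ C ∩ (X ∩ ∁ T) ∣ / 2) Xs)
        ≤⟨ sum-map-mono (λ X → ≤-trans (m/2+n/2≤[m+n]/2 (∣ T ∩ X ∣) (∣ C ∩ (X ∩ ∁ T) ∣))
                                       (/-monoˡ-≤ 2 (∣p∩r∣+∣q∩r∩∁p∣≤∣[p∪q]∩r∣ T C X))) Xs ⟩
      rˣ (T ∪ C)                                                 ∎

  x∈Y∈Ys∧x∉T⇒r[T]<r[T∪⁅x⁆] : ∀ {Y} → Y ∈ₗ Ys → x ∈ Y → x ∉ T → r Xs Ys T < r Xs Ys (T ∪ ⁅ x ⁆)
  x∈Y∈Ys∧x∉T⇒r[T]<r[T∪⁅x⁆] {x = x} {Y} Y∈Ys x∈Y x∉T =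
    +-mono-≤-< (rˣ-mono ⁅ x ⁆)
               (sum-map-mono-< (∣p∩r∣≤∣[p∪q]∩r∣ T ⁅ x ⁆) Y∈Ys (x∈r∧x∉p⇒∣p∩r∣<∣[p∪⁅x⁆]∩r∣ T Y x∈Y x∉T))

  x∈X∈Xs∧x∉T∧2∤∣T∩X∣⇒r[T]<r[T∪⁅x⁆] : ∀ {X} → X ∈ₗ Xs → x ∈ X → x ∉ T → ¬ 2 ∣ ∣ T ∩ X ∣ →
                                        r Xs Ys T < r Xs Ys (T ∪ ⁅ x ⁆)
  x∈X∈Xs∧x∉T∧2∤∣T∩X∣⇒r[T]<r[T∪⁅x⁆] {x = x} {X} X∈Xs x∈X x∉T odd =
    +-mono-<-≤ (sum-map-mono-< (λ X → /-monoˡ-≤ 2 (∣p∩r∣≤∣[p∪q]∩r∣ T ⁅ x ⁆ X)) X∈Xs half-grows)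
               (rʸ-mono ⁅ x ⁆)
    where
    open ≤-Reasoning
    half-grows : ∣ T ∩ X ∣ / 2 < ∣ (T ∪ ⁅ x ⁆) ∩ X ∣ / 2
    half-grows = begin-strict
      ∣ T ∩ X ∣ / 2           <⟨ n<1+n _ ⟩
      1 + ∣ T ∩ X ∣ / 2       ≡⟨ 2∤m⇒[1+m]/2≡1+m/2 _ odd ⟨
      (1 + ∣ T ∩ X ∣) / 2     ≤⟨ /-monoˡ-≤ 2 (x∈r∧x∉p⇒∣p∩r∣<∣[p∪⁅x⁆]∩r∣ T X x∈X x∉T) ⟩
      ∣ (T ∪ ⁅ x ⁆) ∩ X ∣ / 2 ∎

  σ-maximal⇒r[T∪C]<r[T]+∣C∣ : ∀ {C} → σ-maximal Xs Ys T → x ∈ C → x ∉ T →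
                              r Xs Ys (T ∪ C) < r Xs Ys T + ∣ C ∣
  σ-maximal⇒r[T∪C]<r[T]+∣C∣ {x = x} {C} (_ , strictly-maximal) x∈C x∉T =
    +-cancelʳ-< ∣ T ∣ _ _ (begin-strict
      r′ + ∣ T ∣           <⟨ +m-+n<+o-+p⇒m+p<o+n r′ (∣ T ∪ C ∣) r₀ (∣ T ∣) σ[T∪C]<σ[T] ⟩
      r₀ + ∣ T ∪ C ∣       ≤⟨ +-monoʳ-≤ r₀ (∣p∪q∣≤∣p∣+∣q∣ T C) ⟩
      r₀ + (∣ T ∣ + ∣ C ∣) ≡⟨ x∙yz≈xz∙y r₀ (∣ T ∣) (∣ C ∣) ⟩
      r₀ + ∣ C ∣ + ∣ T ∣   ∎)
    where
    open ≤-Reasoning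
    r₀ r′ : ℕ
    r₀ = r Xs Ys T
    r′ = r Xs Ys (T ∪ C)
    σ[T∪C]<σ[T] : σ Xs Ys (T ∪ C) ℤ.< σ Xs Ys T
    σ[T∪C]<σ[T] = strictly-maximal (T ∪ C) (p⊆p∪q C , x , q⊆p∪q T C x∈C , x∉T)

  σ-maximal⇒r[T∪⁅x⁆]≤r[T] : σ-maximal Xs Ys T → x ∉ T → r Xs Ys (T ∪ ⁅ x ⁆) ≤ r Xs Ys T
  σ-maximal⇒r[T∪⁅x⁆]≤r[T] {x = x} maximal x∉T = m<1+n⇒m≤n (subst (r Xs Ys (T ∪ ⁅ x ⁆) <_)
    (trans (cong (r Xs Ys T +_) (∣⁅x⁆∣≡1 x)) (+-comm (r Xs Ys T) 1))
    (σ-maximal⇒r[T∪C]<r[T]+∣C∣ maximal (x∈⁅x⁆ x) x∉T))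

lemma3p1 : {n : ℕ} (Xs Ys : List (Subset n)) (T : Subset n) →
    σ-maximal Xs Ys T →
    ((Y : Subset n) → Y ∈ₗ Ys → Y ⊆ T) ×
    ((X : Subset n) → X ∈ₗ Xs → (X ⊆ T) ⊎ (2 ∣ ∣ T ∩ X ∣)) ×
    IsHyperforest (induced Xs (∁ T))
lemma3p1 Xs Ys T maximal = Ys⊆T , Xs⊆T⊎even , acyclic
  where
  Ys⊆T : ∀ Y → Y ∈ₗ Ys → Y ⊆ T
  Ys⊆T Y Y∈Ys {x} x∈Y = decidable-stable (x ∈? T) λ x∉T →
    <⇒≱ (x∈Y∈Ys∧x∉T⇒r[T]<r[T∪⁅x⁆] Xs Ys T Y∈Ys x∈Y x∉T)
        (σ-maximal⇒r[T∪⁅x⁆]≤r[T] Xs Ys T maximal x∉T)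

  Xs⊆T⊎even : ∀ X → X ∈ₗ Xs → X ⊆ T ⊎ 2 ∣ ∣ T ∩ X ∣
  Xs⊆T⊎even X X∈Xs with 2 ∣? ∣ T ∩ X ∣
  ... | yes even = inj₂ even
  ... | no  odd  = inj₁ λ {x} x∈X → decidable-stable (x ∈? T) λ x∉T →
    <⇒≱ (x∈X∈Xs∧x∉T∧2∤∣T∩X∣⇒r[T]<r[T∪⁅x⁆] Xs Ys T X∈Xs x∈X x∉T odd)
        (σ-maximal⇒r[T∪⁅x⁆]≤r[T] Xs Ys T maximal x∉T)

  acyclic : IsHyperforest (induced Xs (∁ T))
  acyclic (zero , () , _)
  acyclic (k@(suc _) , 2≤k , u , e , u-inj , e-inj , u∈∁T , u∈e) =
    <⇒≱ (σ-maximal⇒r[T∪C]<r[T]+∣C∣ Xs Ys T maximal (∈-image u zero) (x∈∁p⇒x∉p (u∈∁T zero))) (begin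
      r Xs Ys T + ∣ C ∣ ≤⟨ +-monoʳ-≤ _ (∣image∣≤k u) ⟩
      r Xs Ys T + k     ≤⟨ +-monoʳ-≤ _ k≤gain ⟩
      r Xs Ys T + gain  ≤⟨ r[T]+∑⌊∣C∩X∩∁T∣/2⌋≤r[T∪C] Xs Ys T C ⟩
      r Xs Ys (T ∪ C)   ∎)
    where
    open ≤-Reasoning
    C = image u
    gain = sum (map (λ X → ∣ C ∩ (X ∩ ∁ T) ∣ / 2) Xs)
    k≤gain : k ≤ gain
    k≤gain = ≤-trans (cycle-length≤∑⌊∣C∩E∣/2⌋ (induced Xs (∁ T)) 2≤k u e u-inj e-inj u∈e)
                     (sum-map-edges-induced≤ (λ E → ∣ C ∩ E ∣ / 2) Xs (∁ T))
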